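{- There is a sentence $\Phi$ in $\mathrm{MPART}$ such that, for any sentence $\Psi$ in $\mathrm{MMSNP}$, $\Phi$ is not logically equivalent to $\Psi$.
   Context: An $\mathrm{SNP}$ $\tau$-sentence ($\tau$ a finite relational signature) is written in the form $\exists X_1,\ldots,X_s\,\forall \mathbf{x}\,\bigwedge_i \neg(\alpha_i\wedge\beta_i\wedge\epsilon_i)$, where $\sigma=\{X_1,\dots,X_s\}$ are existentially quantified relation symbols, each $\alpha_i$ is a conjunction of atomic or negated atomic $\tau$-formulas, each $\beta_i$ a conjunction of atomic or negated atomic $\sigma$-formulas, and each $\epsilon_i$ a conjunction of inequalities between variables. $\mathrm{MMSNP}$ is the class of such sentences with all $X_j$ unary, no negated $\tau$-atoms in any $\alpha_i$, and every $\epsilon_i$ empty. $\mathrm{MPART}$ is the class of such sentences where each $\alpha_i$ is either a conjunction only of nonnegated $\tau$-atoms or a conjunction only of negated $\tau$-atoms, each $\beta_i$ is a conjunction of unary $\sigma$-atoms or negated unary $\sigma$-atoms, and each $\epsilon_i$ is empty. Logical equivalence means being satisfied by exactly the same $\tau$-structures. -}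

module Defs where

open import Data.Nat using (ℕ)
open import Data.Fin using (Fin)
open import Data.Bool using (Bool; true; false)
open import Data.List using (List; [])
open import Data.List.Relation.Unary.All using (All)
open import Data.Product using (Σ; _×_; _,_)
open import Data.Unit using (⊤)
open import Data.Empty using (⊥)
open import Relation.Binary.PropositionalEquality using (_≡_; _≢_)
open import Relation.Nullary using (¬_)

record Signature : Set where
  field
    size  : ℕ
    arity : Fin size → ℕ
open Signature public

record Atom (S : Signature) (v : ℕ) : Set where
  constructor atom
  field
    sym  : Fin (size S)
    args : Fin (arity S sym) → Fin v
open Atom public

record Literal (S : Signature) (v : ℕ) : Set where
  constructor lit
  field
    positive : Bool
    theAtom  : Atom S v
open Literal public

-- A conjunct  ¬(α ∧ β ∧ ε)  of an SNP sentence with τ the input signature,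
-- σ the existentially quantified signature, and v universally quantified variables.
record Clause (τ σ : Signature) (v : ℕ) : Set where
  constructor clause
  field
    α : List (Literal τ v)
    β : List (Literal σ v)
    ε : List (Fin v × Fin v)    -- (i , j) stands for the inequality x_i ≠ x_j
open Clause public

-- An SNP τ-sentence  ∃X₁…Xₛ ∀x₁…xᵥ ⋀ᵢ ¬(αᵢ ∧ βᵢ ∧ εᵢ).
record SNP (τ : Signature) : Set where
  field
    σ       : Signature
    nvars   : ℕ
    clauses : List (Clause τ σ nvars)
open SNP public

record Structure (S : Signature) : Set₁ where
  field
    Carrier : Set
    rel     : (R : Fin (size S)) → (Fin (arity S R) → Carrier) → Set
open Structure public

holdsAtom : ∀ {S v} (M : Structure S) → (Fin v → Carrier M) → Atom S v → Set
holdsAtom M g (atom R xs) = rel M R (λ k → g (xs k))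

holdsLit : ∀ {S v} (M : Structure S) → (Fin v → Carrier M) → Literal S v → Set
holdsLit M g (lit true  a) = holdsAtom M g a
holdsLit M g (lit false a) = ¬ holdsAtom M g a

Expansion : ∀ {τ} (A : Structure τ) (σ : Signature) → Set₁
Expansion A σ = (X : Fin (size σ)) → (Fin (arity σ X) → Carrier A) → Set

asStructure : ∀ {τ} (A : Structure τ) (σ : Signature) → Expansion A σ → Structure σ
asStructure A σ I = record { Carrier = Carrier A ; rel = I }

clauseHolds : ∀ {τ σ v} (A : Structure τ) (I : Expansion A σ) →
              (Fin v → Carrier A) → Clause τ σ v → Set
clauseHolds {σ = σ} A I g (clause a b e) =
  ¬ ( All (holdsLit A g) a
    × All (holdsLit (asStructure A σ I) g) b
    × All (λ p → g (Data.Product.proj₁ p) ≢ g (Data.Product.proj₂ p)) e )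

_⊨_ : ∀ {τ} → Structure τ → SNP τ → Set₁
A ⊨ Φ = Σ (Expansion A (σ Φ)) λ I →
          (g : Fin (nvars Φ) → Carrier A) → All (clauseHolds A I g) (clauses Φ)

Equivalent : ∀ {τ} → SNP τ → SNP τ → Set₁
Equivalent {τ} Φ Ψ = (A : Structure τ) → (A ⊨ Φ → A ⊨ Ψ) × (A ⊨ Ψ → A ⊨ Φ)

isPositive : ∀ {S v} → Literal S v → Set
isPositive l = positive l ≡ true

isNegative : ∀ {S v} → Literal S v → Set
isNegative l = positive l ≡ false

isEmpty : ∀ {A : Set} → List A → Set
isEmpty xs = xs ≡ []

MMSNP : ∀ {τ} → SNP τ → Set
MMSNP Φ = ((X : Fin (size (σ Φ))) → arity (σ Φ) X ≡ 1)
        × All (λ c → All isPositive (α c) × isEmpty (ε c)) (clauses Φ)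

MPART : ∀ {τ} → SNP τ → Set
MPART Φ = All (λ c → (All isPositive (α c) Data.Sum.⊎ All isNegative (α c))
                   × All (λ l → arity (σ Φ) (sym (theAtom l)) ≡ 1) (β c)
                   × isEmpty (ε c)) (clauses Φ)
  where import Data.Sum

-- Positive input literals make every MMSNP sentence preserved under deleting
-- tuples from the input relations (keeping the domain). The MPART sentence
-- ∀x ¬¬R(x), saying that the unary relation R holds everywhere, is not: it holds
-- in the one-point structure with R full and fails once R is emptied.
module Submission where

open import Defs
open import Data.Product using (Σ; _×_; _,_; proj₁; proj₂)
open import Relation.Nullary using (¬_)
open import Data.Fin using (Fin; zero)
open import Data.Bool using (true; false)
open import Data.List using ([]; _∷_)
open import Data.List.Relation.Unary.All as All using (All; []; _∷_)
open import Data.Unit using (⊤; tt)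
open import Data.Empty using (⊥)
open import Data.Sum using (inj₂)
open import Relation.Binary.PropositionalEquality using (refl)

Relations : ∀ {τ} → Structure τ → Set₁
Relations {τ} A = (R : Fin (size τ)) → (Fin (arity τ R) → Carrier A) → Set

withRelations : ∀ {τ} (A : Structure τ) → Relations A → Structure τ
withRelations A S = record { Carrier = Carrier A ; rel = S }

module _ {τ} (A : Structure τ) {S : Relations A} (S⊆A : ∀ R xs → S R xs → rel A R xs) where

  holdsLit-reflect : ∀ {v} {g : Fin v → Carrier A} {l : Literal τ v} →
                     isPositive l → holdsLit (withRelations A S) g l → holdsLit A g l
  holdsLit-reflect {g = g} {l = lit true (atom R xs)} refl = S⊆A R (λ k → g (xs k))

  clauseHolds-antitone : ∀ {σ v} (I : Expansion A σ) (g : Fin v → Carrier A)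
                         (c : Clause τ σ v) → All isPositive (α c) →
                         clauseHolds A I g c → clauseHolds (withRelations A S) I g c
  clauseHolds-antitone I g (clause a b e) pos A⊨c (Sa , Ib , Ie) =
    A⊨c (All.zipWith (λ (p , h) → holdsLit-reflect p h) (pos , Sa) , Ib , Ie)

  ⊨-antitone-MMSNP : (Ψ : SNP τ) → MMSNP Ψ → A ⊨ Ψ → withRelations A S ⊨ Ψ
  ⊨-antitone-MMSNP Ψ (_ , mm) (I , A⊨Ψ) = I , λ g →
    All.zipWith (λ ((pos , _) , h) → clauseHolds-antitone I g _ pos h) (mm , A⊨Ψ g)

unary : Signature
unary = record { size = 1 ; arity = λ _ → 1 }

noRelations : Signature
noRelations = record { size = 0 ; arity = λ () }

everywhere : SNP unary
everywhere = record
  { σ       = noRelations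
  ; nvars   = 1
  ; clauses = clause (lit false (atom zero (λ _ → zero)) ∷ []) [] [] ∷ []
  }

everywhere-MPART : MPART everywhere
everywhere-MPART = (inj₂ (refl ∷ []) , [] , refl) ∷ []

point : Structure unary
point = record { Carrier = ⊤ ; rel = λ _ _ → ⊤ }

emptyPoint : Structure unary
emptyPoint = withRelations point (λ _ _ → ⊥)

point⊨everywhere : point ⊨ everywhere
point⊨everywhere = (λ ()) , λ _ → (λ { ((¬R ∷ []) , _) → ¬R tt }) ∷ []

emptyPoint⊭everywhere : ¬ (emptyPoint ⊨ everywhere)
emptyPoint⊭everywhere (_ , sat) with sat (λ _ → tt)
... | clause-holds ∷ [] = clause-holds (((λ ()) ∷ []) , [] , [])

proposition1 : Σ Signature λ τ → Σ (SNP τ) λ Φ →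
                 MPART Φ × ((Ψ : SNP τ) → MMSNP Ψ → ¬ Equivalent Φ Ψ)
proposition1 = unary , everywhere , everywhere-MPART , λ Ψ mmsnp Φ⇔Ψ →
  let point⊨Ψ      = proj₁ (Φ⇔Ψ point) point⊨everywhere
      emptyPoint⊨Ψ = ⊨-antitone-MMSNP point (λ _ _ ()) Ψ mmsnp point⊨Ψ
  in emptyPoint⊭everywhere (proj₂ (Φ⇔Ψ emptyPoint) emptyPoint⊨Ψ)
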